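{- Let $F$ be a formula in CNF that does not contain the equality predicate. If a clause $C$ is blocked in $F$, then $C$ is redundant with respect to $F$, i.e., $F \setminus \{C\}$ and $F \cup \{C\}$ are satisfiability equivalent.
   Context: First-order logic. A literal is an atom or a negated atom; for a literal $L$, $\bar L$ denotes its complement. A clause is a disjunction of literals, treated as a multiset of literals; a formula in CNF is a finite set of clauses; variables of clauses are implicitly universally quantified, and distinct clauses are assumed to be variable disjoint. A clause is valid if it is true in every interpretation (in the absence of equality, iff it contains a pair of complementary literals). $L$-resolvent: given clauses $C = L \lor C'$ and $D = N_1 \lor \dots \lor N_l \lor D'$ with $l > 0$ (variable disjoint) such that $L, \bar N_1, \dots, \bar N_l$ are unifiable with most general unifier $\sigma$, the clause $C'\sigma \lor D'\sigma$ is an $L$-resolvent of $C$ and $D$. A clause $C$ is blocked by a literal $L \in C$ in a formula $F$ if every $L$-resolvent of $C$ with a clause in $F \setminus \{C\}$ is valid; $C$ is blocked in $F$ if it is blocked by some literal of $C$. Two formulas are satisfiability equivalent if both are satisfiable or both are unsatisfiable. -}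

module Defs where

open import Data.Nat using (ℕ)
open import Data.Vec using (Vec; []; _∷_)
open import Data.List using (List; []; _∷_; _++_; map)
open import Data.List.Membership.Propositional using (_∈_)
open import Data.List.Relation.Unary.Any using (Any)
open import Data.List.Relation.Binary.Permutation.Propositional using (_↭_)
open import Data.Product using (Σ; _×_)
open import Data.Sum using (_⊎_)
open import Data.Empty using (⊥)
open import Relation.Nullary using (¬_)
open import Relation.Binary.PropositionalEquality using (_≡_; _≢_)

-- A first-order signature WITHOUT a built-in equality predicate:
-- function symbols and predicate symbols with arities.
record Signature : Set₁ where
  field
    Fun    : Set
    Pred   : Set
    fArity : Fun → ℕ
    pArity : Pred → ℕ

module FOL (Sig : Signature) where
  open Signature Sig

  data Term : Set where
    var : ℕ → Term
    fn  : (f : Fun) → Vec Term (fArity f) → Term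

  record Atom : Set where
    constructor atom
    field
      pr   : Pred
      args : Vec Term (pArity pr)

  data Literal : Set where
    pos : Atom → Literal
    neg : Atom → Literal

  compl : Literal → Literal
  compl (pos A) = neg A
  compl (neg A) = pos A

  -- A clause is a multiset of literals (list, compared up to permutation _↭_).
  Clause : Set
  Clause = List Literal

  Formula : Set
  Formula = List Clause

  Subst : Set
  Subst = ℕ → Term

  mutual
    substT : Subst → Term → Term
    substT σ (var x)   = σ x
    substT σ (fn f ts) = fn f (substTs σ ts)

    substTs : ∀ {n} → Subst → Vec Term n → Vec Term n
    substTs σ []       = []
    substTs σ (t ∷ ts) = substT σ t ∷ substTs σ ts

  substA : Subst → Atom → Atom
  substA σ (atom p ts) = atom p (substTs σ ts)

  substL : Subst → Literal → Literal
  substL σ (pos A) = pos (substA σ A)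
  substL σ (neg A) = neg (substA σ A)

  substC : Subst → Clause → Clause
  substC σ C = map (substL σ) C

  Unifies : Subst → List Literal → Set
  Unifies σ Ls = ∀ {K M} → K ∈ Ls → M ∈ Ls → substL σ K ≡ substL σ M

  IsMGU : Subst → List Literal → Set
  IsMGU σ Ls = Unifies σ Ls
             × (∀ τ → Unifies τ Ls → Σ Subst λ ρ → ∀ x → τ x ≡ substT ρ (σ x))

  mutual
    OccT : ℕ → Term → Set
    OccT x (var y)   = x ≡ y
    OccT x (fn f ts) = OccTs x ts

    OccTs : ∀ {n} → ℕ → Vec Term n → Set
    OccTs x []       = ⊥
    OccTs x (t ∷ ts) = OccT x t ⊎ OccTs x ts

  OccL : ℕ → Literal → Set
  OccL x (pos (atom p ts)) = OccTs x ts
  OccL x (neg (atom p ts)) = OccTs x ts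

  OccC : ℕ → Clause → Set
  OccC x C = Any (OccL x) C

  VarDisjoint : Clause → Clause → Set
  VarDisjoint C D = ∀ x → OccC x C → OccC x D → ⊥

  Resolvent : Literal → Clause → Clause → Clause → Set
  Resolvent L C D R =
    Σ Clause λ C' → Σ (List Literal) λ Ns → Σ Clause λ D' → Σ Subst λ σ →
      (C ↭ (L ∷ C'))
    × (D ↭ (Ns ++ D'))
    × (Ns ≢ [])
    × IsMGU σ (L ∷ map compl Ns)
    × (R ≡ substC σ (C' ++ D'))

  record Structure : Set₁ where
    field
      Dom   : Set
      elem  : Dom
      funI  : (f : Fun) → Vec Dom (fArity f) → Dom
      predI : (p : Pred) → Vec Dom (pArity p) → Set

  module _ (I : Structure) where
    open Structure I

    mutual
      evalT : (ℕ → Dom) → Term → Dom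
      evalT α (var x)   = α x
      evalT α (fn f ts) = funI f (evalTs α ts)

      evalTs : ∀ {n} → (ℕ → Dom) → Vec Term n → Vec Dom n
      evalTs α []       = []
      evalTs α (t ∷ ts) = evalT α t ∷ evalTs α ts

    LitTrue : (ℕ → Dom) → Literal → Set
    LitTrue α (pos (atom p ts)) = predI p (evalTs α ts)
    LitTrue α (neg (atom p ts)) = ¬ predI p (evalTs α ts)

    Satisfies : Clause → Set
    Satisfies C = ∀ (α : ℕ → Dom) → Any (LitTrue α) C

  Valid : Clause → Set₁
  Valid C = ∀ (I : Structure) → Satisfies I C

  ClauseSet : Set₁
  ClauseSet = Clause → Set

  _∖[_] : Formula → Clause → ClauseSet
  (F ∖[ C ]) D = D ∈ F × ¬ (D ↭ C)

  _∪[_] : Formula → Clause → ClauseSet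
  (F ∪[ C ]) D = D ∈ F ⊎ D ↭ C

  Satisfiable : ClauseSet → Set₁
  Satisfiable S = Σ Structure λ I → ∀ D → S D → Satisfies I D

  SatEquivalent : ClauseSet → ClauseSet → Set₁
  SatEquivalent S T = (Satisfiable S → Satisfiable T) × (Satisfiable T → Satisfiable S)

  BlockedBy : Literal → Clause → Formula → Set₁
  BlockedBy L C F = L ∈ C × (∀ D R → (F ∖[ C ]) D → Resolvent L C D R → Valid R)

  Blocked : Clause → Formula → Set₁
  Blocked C F = Σ Literal λ L → BlockedBy L C F

-- Starting from a model I of F ∖ {C}, build a model of F ∪ {C} over the terms made of the symbols of
-- F and C: an atom is true as in I unless it has been flipped, and flipped atoms take the value that
-- makes L true.  The instances of C are enumerated and processed one at a time; when an instance Cλ is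
-- false, the atom of Lλ is flipped.  A flip never falsifies an instance Dβ of a clause of F ∖ {C}: the
-- literals of Dβ that lose their truth have the atom of Lλ with the opposite sign, so λ and β (which
-- act on disjoint variables) combine into a unifier of L with their complements, and the resulting
-- L-resolvent, valid because C is blocked, would have to contain a literal true at that instance,
-- whereas its literals from C are false as Cλ is and those from D are false as Dβ is.  Flips only add
-- atoms, so in the union of the ω stages every instance of a clause is eventually stable, and the union
-- satisfies F ∪ {C}.

module Submission where

open import Defs
open import Level using (0ℓ)
open import Axiom.ExcludedMiddle using (ExcludedMiddle)
open import Data.Nat using (ℕ; zero; suc; _+_; _≤_; _<_; _≤′_; ≤′-refl; ≤′-step; z≤n; s≤s; _≟_)
open import Data.Nat.Properties
open import Data.Nat.Tactic.RingSolver using (solve-∀)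
open import Data.Vec as Vec using (Vec; []; _∷_)
open import Data.List using (List; []; _∷_; _++_; map; concatMap; length; filter; foldl)
open import Data.List.Properties using (partition-defn)
import Data.List.Relation.Binary.Permutation.Setoid.Properties as ↭ₛ
open import Relation.Unary using (Pred; Decidable)
open import Relation.Unary.Properties using (∁?)
open import Data.List.Relation.Binary.Subset.Propositional using (_⊆_)
import Data.Vec.Relation.Unary.All as VAll
import Data.Vec.Properties as Vec
open import Data.List.Membership.Propositional using (_∈_; find; lose)
open import Data.List.Membership.Propositional.Properties using (∈-++⁺ˡ; ∈-++⁺ʳ; ∈-concatMap⁺; ∈-concatMap⁻; ∈-map⁺; ∈-map⁻; ∈-∃++; ∈-filter⁺; ∈-filter⁻)
open import Data.List.Relation.Binary.Permutation.Propositional using (_↭_; ↭-sym; ↭ₛ⇒↭)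
open import Data.List.Relation.Binary.Permutation.Propositional.Properties using (shift; ∈-resp-↭; Any-resp-↭)
open import Axiom.DoubleNegationElimination using (em⇒dne)
open import Data.List.Relation.Unary.Any as Any using (Any; here; there)
import Data.List.Relation.Unary.Any.Properties as Any
open import Data.List.Relation.Unary.All as All using (All; []; _∷_)
import Data.List.Relation.Unary.All.Properties as All
open import Data.Product as Product using (Σ; ∃; _×_; _,_; proj₁; proj₂)
open import Data.Sum as Sum using (_⊎_; inj₁; inj₂; [_,_])
open import Data.Empty using (⊥; ⊥-elim)
open import Data.Unit using (⊤)
open import Function using (_∘_; id; _⇔_; mk⇔; Equivalence)
import Function.Properties.Equivalence as ⇔
open import Relation.Nullary using (¬_; Dec; yes; no)
open import Relation.Binary.PropositionalEquality using (_≡_; _≢_; refl; sym; trans; cong; cong₂; subst; setoid; module ≡-Reasoning)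

ascending-mono : ∀ {A : Set} (P : ℕ → A → Set) → (∀ {n x} → P n x → P (suc n) x) →
                 ∀ {m n x} → m ≤ n → P m x → P n x
ascending-mono P step {m} m≤n = go (≤⇒≤′ m≤n)
  where
  go : ∀ {n x} → m ≤′ n → P m x → P n x
  go ≤′-refl        = id
  go (≤′-step m≤′n) = step ∘ go m≤′n

∈⇒↭∷ : ∀ {A : Set} {x : A} {xs} → x ∈ xs → ∃ λ ys → xs ↭ x ∷ ys
∈⇒↭∷ {x = x} x∈xs with ∈-∃++ x∈xs
... | ys , zs , refl = ys ++ zs , shift x ys zs

↭-filter++filter-∁ : ∀ {A : Set} {P : Pred A 0ℓ} (P? : Decidable P) xs → xs ↭ filter P? xs ++ filter (∁? P?) xs
↭-filter++filter-∁ {A} P? xs =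
  subst (λ (ys , zs) → xs ↭ ys ++ zs) (partition-defn P? xs) (↭ₛ⇒↭ (↭ₛ.partition-↭ (setoid A) P? xs))

∈⇒≢[] : ∀ {A : Set} {x : A} {xs} → x ∈ xs → xs ≢ []
∈⇒≢[] () refl

module Syntax (Sig : Signature) where
  open Signature Sig
  open FOL Sig

  infixl 5 _⨾_
  _⨾_ : Subst → Subst → Subst
  (σ ⨾ ρ) x = substT ρ (σ x)

  mutual
    substT-cong : ∀ {σ τ} t → (∀ x → OccT x t → σ x ≡ τ x) → substT σ t ≡ substT τ t
    substT-cong (var x)   eq = eq x refl
    substT-cong (fn f ts) eq = cong (fn f) (substTs-cong ts eq)

    substTs-cong : ∀ {n σ τ} (ts : Vec Term n) → (∀ x → OccTs x ts → σ x ≡ τ x) →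
                   substTs σ ts ≡ substTs τ ts
    substTs-cong []       eq = refl
    substTs-cong (t ∷ ts) eq = cong₂ _∷_ (substT-cong t (λ x → eq x ∘ inj₁)) (substTs-cong ts (λ x → eq x ∘ inj₂))

  mutual
    substT-⨾ : ∀ σ ρ t → substT ρ (substT σ t) ≡ substT (σ ⨾ ρ) t
    substT-⨾ σ ρ (var x)   = refl
    substT-⨾ σ ρ (fn f ts) = cong (fn f) (substTs-⨾ σ ρ ts)

    substTs-⨾ : ∀ {n} σ ρ (ts : Vec Term n) → substTs ρ (substTs σ ts) ≡ substTs (σ ⨾ ρ) ts
    substTs-⨾ σ ρ []       = refl
    substTs-⨾ σ ρ (t ∷ ts) = cong₂ _∷_ (substT-⨾ σ ρ t) (substTs-⨾ σ ρ ts)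

  mutual
    substT-var : ∀ t → substT var t ≡ t
    substT-var (var x)   = refl
    substT-var (fn f ts) = cong (fn f) (substTs-var ts)

    substTs-var : ∀ {n} (ts : Vec Term n) → substTs var ts ≡ ts
    substTs-var []       = refl
    substTs-var (t ∷ ts) = cong₂ _∷_ (substT-var t) (substTs-var ts)

  mutual
    OccT-substT⁻ : ∀ σ t {y} → OccT y (substT σ t) → ∃ λ z → OccT z t × OccT y (σ z)
    OccT-substT⁻ σ (var x)   o = x , refl , o
    OccT-substT⁻ σ (fn f ts) o = OccTs-substTs⁻ σ ts o

    OccTs-substTs⁻ : ∀ {n} σ (ts : Vec Term n) {y} → OccTs y (substTs σ ts) → ∃ λ z → OccTs z ts × OccT y (σ z)
    OccTs-substTs⁻ σ (t ∷ ts) (inj₁ o) = let z , oz , oy = OccT-substT⁻ σ t o in z , inj₁ oz , oy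
    OccTs-substTs⁻ σ (t ∷ ts) (inj₂ o) = let z , oz , oy = OccTs-substTs⁻ σ ts o in z , inj₂ oz , oy

  atomOf : Literal → Atom
  atomOf (pos A) = A
  atomOf (neg A) = A

  Positive : Literal → Set
  Positive (pos _) = ⊤
  Positive (neg _) = ⊥

  SameSign : Literal → Literal → Set
  SameSign K (pos _) = Positive K
  SameSign K (neg _) = ¬ Positive K

  SameSign-refl : ∀ K → SameSign K K
  SameSign-refl (pos _) = _
  SameSign-refl (neg _) = λ ()

  substL-cong : ∀ {σ τ} K → (∀ x → OccL x K → σ x ≡ τ x) → substL σ K ≡ substL τ K
  substL-cong (pos (atom p ts)) eq = cong (pos ∘ atom p) (substTs-cong ts eq)
  substL-cong (neg (atom p ts)) eq = cong (neg ∘ atom p) (substTs-cong ts eq)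

  substL-⨾ : ∀ σ ρ K → substL ρ (substL σ K) ≡ substL (σ ⨾ ρ) K
  substL-⨾ σ ρ (pos (atom p ts)) = cong (pos ∘ atom p) (substTs-⨾ σ ρ ts)
  substL-⨾ σ ρ (neg (atom p ts)) = cong (neg ∘ atom p) (substTs-⨾ σ ρ ts)

  substL-compl : ∀ σ K → substL σ (compl K) ≡ compl (substL σ K)
  substL-compl σ (pos A) = refl
  substL-compl σ (neg A) = refl

  module _ (I : Structure) where
    open Structure I

    mutual
      evalT-substT : ∀ α σ t → evalT I α (substT σ t) ≡ evalT I (evalT I α ∘ σ) t
      evalT-substT α σ (var x)   = refl
      evalT-substT α σ (fn f ts) = cong (funI f) (evalTs-substTs α σ ts)

      evalTs-substTs : ∀ {n} α σ (ts : Vec Term n) → evalTs I α (substTs σ ts) ≡ evalTs I (evalT I α ∘ σ) ts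
      evalTs-substTs α σ []       = refl
      evalTs-substTs α σ (t ∷ ts) = cong₂ _∷_ (evalT-substT α σ t) (evalTs-substTs α σ ts)

  mutual
    sizeT : Term → ℕ
    sizeT (var x)   = 1
    sizeT (fn f ts) = suc (sizeTs ts)

    sizeTs : ∀ {n} → Vec Term n → ℕ
    sizeTs []       = 0
    sizeTs (t ∷ ts) = sizeT t + sizeTs ts

  mutual
    sizeT-occ : ∀ σ t {x} → OccT x t → sizeT (σ x) ≤ sizeT (substT σ t)
    sizeT-occ σ (var y)   refl = ≤-refl
    sizeT-occ σ (fn f ts) o    = m≤n⇒m≤1+n (sizeTs-occ σ ts o)

    sizeTs-occ : ∀ {n} σ (ts : Vec Term n) {x} → OccTs x ts → sizeT (σ x) ≤ sizeTs (substTs σ ts)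
    sizeTs-occ σ (t ∷ ts) (inj₁ o) = ≤-trans (sizeT-occ σ t o) (m≤m+n _ _)
    sizeTs-occ σ (t ∷ ts) (inj₂ o) = ≤-trans (sizeTs-occ σ ts o) (m≤n+m _ _)

  occurs-check : ∀ σ {x f} (ts : Vec Term (fArity f)) → OccTs x ts → σ x ≢ substT σ (fn f ts)
  occurs-check σ ts o eq = <-irrefl (cong sizeT eq) (s≤s (sizeTs-occ σ ts o))

  mutual
    varsT : Term → List ℕ
    varsT (var x)   = x ∷ []
    varsT (fn f ts) = varsTs ts

    varsTs : ∀ {n} → Vec Term n → List ℕ
    varsTs []       = []
    varsTs (t ∷ ts) = varsT t ++ varsTs ts

  mutual
    OccT⇒∈varsT : ∀ t {x} → OccT x t → x ∈ varsT t
    OccT⇒∈varsT (var y)   refl = here refl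
    OccT⇒∈varsT (fn f ts) o    = OccTs⇒∈varsTs ts o

    OccTs⇒∈varsTs : ∀ {n} (ts : Vec Term n) {x} → OccTs x ts → x ∈ varsTs ts
    OccTs⇒∈varsTs (t ∷ ts) (inj₁ o) = ∈-++⁺ˡ (OccT⇒∈varsT t o)
    OccTs⇒∈varsTs (t ∷ ts) (inj₂ o) = ∈-++⁺ʳ (varsT t) (OccTs⇒∈varsTs ts o)

  mutual
    symsT : Term → List Fun
    symsT (var x)   = []
    symsT (fn f ts) = f ∷ symsTs ts

    symsTs : ∀ {n} → Vec Term n → List Fun
    symsTs []       = []
    symsTs (t ∷ ts) = symsT t ++ symsTs ts

  symsL : Literal → List Fun
  symsL K = symsTs (Atom.args (atomOf K))

  symsC : Clause → List Fun
  symsC = concatMap symsL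

  symsF : Formula → List Fun
  symsF = concatMap symsC

  varsL : Literal → List ℕ
  varsL (pos (atom p ts)) = varsTs ts
  varsL (neg (atom p ts)) = varsTs ts

  varsC : Clause → List ℕ
  varsC = concatMap varsL

  OccC⇒∈varsC : ∀ C {x} → OccC x C → x ∈ varsC C
  OccC⇒∈varsC C o = ∈-concatMap⁺ varsL (Any.map (λ {K} → OccL⇒∈varsL K) o)
    where
    OccL⇒∈varsL : ∀ K {x} → OccL x K → x ∈ varsL K
    OccL⇒∈varsL (pos (atom p ts)) = OccTs⇒∈varsTs ts
    OccL⇒∈varsL (neg (atom p ts)) = OccTs⇒∈varsTs ts

module Unification (em : ExcludedMiddle 0ℓ) (Sig : Signature) where
  open Signature Sig
  open FOL Sig
  open Syntax Sig

  MostGeneral : (Subst → Set) → Subst → Set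
  MostGeneral P σ = P σ × (∀ τ → P τ → Σ Subst λ ρ → ∀ x → τ x ≡ substT ρ (σ x))

  MostGeneral-resp : ∀ {P Q : Subst → Set} {σ} → (∀ {τ} → P τ → Q τ) → (∀ {τ} → Q τ → P τ) →
                     MostGeneral P σ → MostGeneral Q σ
  MostGeneral-resp P⇒Q Q⇒P (Pσ , general) = P⇒Q Pσ , λ τ → general τ ∘ Q⇒P

  Equation : Set
  Equation = Term × Term

  Solves : Subst → Equation → Set
  Solves σ (s , t) = substT σ s ≡ substT σ t

  Unifier : List Equation → Subst → Set
  Unifier E σ = All (Solves σ) E

  OccEq : ℕ → Equation → Set
  OccEq x (s , t) = OccT x s ⊎ OccT x t

  OccE : ℕ → List Equation → Set
  OccE x = Any (OccEq x)

  sizeE : List Equation → ℕ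
  sizeE []            = 0
  sizeE ((s , t) ∷ E) = sizeT s + sizeT t + sizeE E

  varsE : List Equation → List ℕ
  varsE = concatMap λ (s , t) → varsT s ++ varsT t

  substE : Subst → List Equation → List Equation
  substE θ = map λ (s , t) → substT θ s , substT θ t

  zipE : ∀ {n} → Vec Term n → Vec Term n → List Equation
  zipE []       []       = []
  zipE (t ∷ ts) (u ∷ us) = (t , u) ∷ zipE ts us

  OccE⇒∈varsE : ∀ E {x} → OccE x E → x ∈ varsE E
  OccE⇒∈varsE E o = ∈-concatMap⁺ _ (Any.map (λ {e} → [ ∈-++⁺ˡ ∘ OccT⇒∈varsT (proj₁ e) , ∈-++⁺ʳ _ ∘ OccT⇒∈varsT (proj₂ e) ]) o)

  Unifier-zipE⁺ : ∀ {n σ} (ts us : Vec Term n) → substTs σ ts ≡ substTs σ us → Unifier (zipE ts us) σ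
  Unifier-zipE⁺ []       []       _  = []
  Unifier-zipE⁺ (t ∷ ts) (u ∷ us) eq = cong Vec.head eq ∷ Unifier-zipE⁺ ts us (cong Vec.tail eq)

  Unifier-zipE⁻ : ∀ {n σ} (ts us : Vec Term n) → Unifier (zipE ts us) σ → substTs σ ts ≡ substTs σ us
  Unifier-zipE⁻ []       []       []       = refl
  Unifier-zipE⁻ (t ∷ ts) (u ∷ us) (e ∷ es) = cong₂ _∷_ e (Unifier-zipE⁻ ts us es)

  Unifier-substE⁻ : ∀ θ σ E → Unifier (substE θ E) σ → Unifier E (θ ⨾ σ)
  Unifier-substE⁻ θ σ E u =
    All.map (λ {e} eq → trans (sym (substT-⨾ θ σ (proj₁ e))) (trans eq (substT-⨾ θ σ (proj₂ e)))) (All.map⁻ u)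

  Unifier-substE⁺ : ∀ θ σ E → Unifier E (θ ⨾ σ) → Unifier (substE θ E) σ
  Unifier-substE⁺ θ σ E u =
    All.map⁺ (All.map (λ {e} eq → trans (substT-⨾ θ σ (proj₁ e)) (trans eq (sym (substT-⨾ θ σ (proj₂ e))))) u)

  Unifier-cong : ∀ {σ τ} E → (∀ x → σ x ≡ τ x) → Unifier E σ → Unifier E τ
  Unifier-cong E σ≗τ = All.map λ {e} eq →
    trans (sym (substT-cong (proj₁ e) (λ x _ → σ≗τ x))) (trans eq (substT-cong (proj₂ e) (λ x _ → σ≗τ x)))

  Unifier-swap : ∀ {σ s t E} → Unifier ((s , t) ∷ E) σ → Unifier ((t , s) ∷ E) σ
  Unifier-swap (eq ∷ u) = sym eq ∷ u

  OccE-swap : ∀ {x s t E} → OccE x ((s , t) ∷ E) → OccE x ((t , s) ∷ E)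
  OccE-swap (here o)  = here (Sum.swap o)
  OccE-swap (there o) = there o

  fn-symbol-injective : ∀ {f g} {xs : Vec Term (fArity f)} {ys : Vec Term (fArity g)} → fn f xs ≡ fn g ys → f ≡ g
  fn-symbol-injective refl = refl

  fn-injective : ∀ {f} {xs ys : Vec Term (fArity f)} → fn f xs ≡ fn f ys → xs ≡ ys
  fn-injective refl = refl

  module _ {f : Fun} {ts us : Vec Term (fArity f)} {E : List Equation} where

    MostGeneral-decompose : ∀ {σ} → MostGeneral (Unifier (zipE ts us ++ E)) σ →
                            MostGeneral (Unifier ((fn f ts , fn f us) ∷ E)) σ
    MostGeneral-decompose = MostGeneral-resp
      (λ u → let args , rest = All.++⁻ (zipE ts us) u in cong (fn f) (Unifier-zipE⁻ ts us args) ∷ rest)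
      (λ { (eq ∷ rest) → All.++⁺ (Unifier-zipE⁺ ts us (fn-injective eq)) rest })

    OccE-decompose : ∀ {x} → OccE x (zipE ts us ++ E) → OccE x ((fn f ts , fn f us) ∷ E)
    OccE-decompose o with Any.++⁻ (zipE ts us) o
    ... | inj₁ o′ = here (OccE-zipE ts us o′)
      where
      OccE-zipE : ∀ {n x} (ts us : Vec Term n) → OccE x (zipE ts us) → OccTs x ts ⊎ OccTs x us
      OccE-zipE []       []       ()
      OccE-zipE (t ∷ ts) (u ∷ us) (here o)  = Sum.map inj₁ inj₁ o
      OccE-zipE (t ∷ ts) (u ∷ us) (there o) = Sum.map inj₂ inj₂ (OccE-zipE ts us o)
    ... | inj₂ o′ = there o′

    sizeE-decompose : sizeE (zipE ts us ++ E) < sizeE ((fn f ts , fn f us) ∷ E)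
    sizeE-decompose = begin-strict
      sizeE (zipE ts us ++ E)                   ≡⟨ sizeE-++ (zipE ts us) ⟩
      sizeE (zipE ts us) + sizeE E              ≡⟨ cong (_+ sizeE E) (sizeE-zipE ts us) ⟩
      sizeTs ts + sizeTs us + sizeE E           <⟨ s≤s (+-monoˡ-≤ (sizeE E) (+-monoʳ-≤ (sizeTs ts) (n≤1+n _))) ⟩
      suc (sizeTs ts) + suc (sizeTs us) + sizeE E ∎
      where
      open ≤-Reasoning
      sizeE-++ : ∀ E₁ → sizeE (E₁ ++ E) ≡ sizeE E₁ + sizeE E
      sizeE-++ []            = refl
      sizeE-++ ((s , t) ∷ E₁) = trans (cong (sizeT s + sizeT t +_) (sizeE-++ E₁)) (sym (+-assoc (sizeT s + sizeT t) (sizeE E₁) (sizeE E)))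
      sizeE-zipE : ∀ {n} (ts us : Vec Term n) → sizeE (zipE ts us) ≡ sizeTs ts + sizeTs us
      sizeE-zipE []       []       = refl
      sizeE-zipE (t ∷ ts) (u ∷ us) rewrite sizeE-zipE ts us = +-interchange (sizeT t) (sizeT u) (sizeTs ts) (sizeTs us)
        where +-interchange : ∀ a b c d → a + b + (c + d) ≡ a + c + (b + d)
              +-interchange = solve-∀

  _↦_ : ℕ → Term → Subst
  (x ↦ t) y with y ≟ x
  ... | yes _ = t
  ... | no  _ = var y

  ↦-self : ∀ x t → (x ↦ t) x ≡ t
  ↦-self x t with x ≟ x
  ... | yes _   = refl
  ... | no  x≢x = ⊥-elim (x≢x refl)

  ↦-fresh : ∀ {x} t → ¬ OccT x t → substT (x ↦ t) t ≡ t
  ↦-fresh {x} t x∉t = trans (substT-cong t identity) (substT-var t)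
    where
    identity : ∀ y → OccT y t → (x ↦ t) y ≡ var y
    identity y o with y ≟ x
    ... | yes refl = ⊥-elim (x∉t o)
    ... | no  _    = refl

  ↦-absorbed : ∀ {x t} τ → τ x ≡ substT τ t → ∀ y → ((x ↦ t) ⨾ τ) y ≡ τ y
  ↦-absorbed {x} τ eq y with y ≟ x
  ... | yes refl = sym eq
  ... | no  _    = refl

  module _ {x : ℕ} {t : Term} (x∉t : ¬ OccT x t) where

    OccT-↦ : ∀ s {y} → OccT y (substT (x ↦ t) s) → (OccT y s ⊎ OccT y t) × y ≢ x
    OccT-↦ s o with OccT-substT⁻ (x ↦ t) s o
    ... | z , oz , oy with z ≟ x
    ...   | yes refl = inj₂ oy , λ { refl → x∉t oy }
    ...   | no  z≢x  = inj₁ (subst (λ w → OccT w s) (sym oy) oz) , λ { refl → z≢x (sym oy) }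

    OccE-↦ : ∀ {E y} → OccE y (substE (x ↦ t) E) → OccE y ((var x , t) ∷ E) × y ≢ x
    OccE-↦ {E} o with find (Any.map⁻ o)
    ... | (s , u) , e∈E , inj₁ os with OccT-↦ s os
    ...   | inj₁ o′ , y≢x = there (lose e∈E (inj₁ o′)) , y≢x
    ...   | inj₂ o′ , y≢x = here (inj₂ o′) , y≢x
    OccE-↦ {E} o | (s , u) , e∈E , inj₂ ou with OccT-↦ u ou
    ...   | inj₁ o′ , y≢x = there (lose e∈E (inj₂ o′)) , y≢x
    ...   | inj₂ o′ , y≢x = here (inj₂ o′) , y≢x

    Unifier-↦ : ∀ {E τ} → Unifier ((var x , t) ∷ E) τ → Unifier (substE (x ↦ t) E) τ
    Unifier-↦ {E} {τ} (eq ∷ u) = Unifier-substE⁺ (x ↦ t) τ E (Unifier-cong E (λ y → sym (↦-absorbed τ eq y)) u)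

    MostGeneral-↦ : ∀ {E σ} → MostGeneral (Unifier (substE (x ↦ t) E)) σ →
                    MostGeneral (Unifier ((var x , t) ∷ E)) ((x ↦ t) ⨾ σ)
    MostGeneral-↦ {E} {σ} (u , general) = solves-x ∷ Unifier-substE⁻ (x ↦ t) σ E u , most-general
      where
      open ≡-Reasoning
      solves-x : substT σ ((x ↦ t) x) ≡ substT ((x ↦ t) ⨾ σ) t
      solves-x = begin
        substT σ ((x ↦ t) x)          ≡⟨ cong (substT σ) (↦-self x t) ⟩
        substT σ t                    ≡⟨ cong (substT σ) (↦-fresh t x∉t) ⟨
        substT σ (substT (x ↦ t) t)   ≡⟨ substT-⨾ (x ↦ t) σ t ⟩
        substT ((x ↦ t) ⨾ σ) t        ∎
      most-general : ∀ τ → Unifier ((var x , t) ∷ E) τ → Σ Subst λ ρ → ∀ y → τ y ≡ substT ρ (((x ↦ t) ⨾ σ) y)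
      most-general τ uτ@(eq ∷ _) with general τ (Unifier-↦ uτ)
      ... | ρ , τ≗σ⨾ρ = ρ , λ y → begin
        τ y                              ≡⟨ ↦-absorbed τ eq y ⟨
        substT τ ((x ↦ t) y)             ≡⟨ substT-cong ((x ↦ t) y) (λ z _ → τ≗σ⨾ρ z) ⟩
        substT (σ ⨾ ρ) ((x ↦ t) y)       ≡⟨ substT-⨾ σ ρ ((x ↦ t) y) ⟨
        substT ρ (substT σ ((x ↦ t) y))  ∎

  count : (ℕ → Set) → List ℕ → ℕ
  count P []      = 0
  count P (x ∷ V) with em {P x}
  ... | yes _ = suc (count P V)
  ... | no  _ = count P V

  count-mono : ∀ {P Q : ℕ → Set} V → (∀ {x} → P x → Q x) → count P V ≤ count Q V
  count-mono []      P⇒Q = z≤n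
  count-mono {P} {Q} (x ∷ V) P⇒Q with em {P x} | em {Q x}
  ... | yes _  | yes _ = s≤s (count-mono V P⇒Q)
  ... | yes px | no ¬q = ⊥-elim (¬q (P⇒Q px))
  ... | no  _  | yes _ = m≤n⇒m≤1+n (count-mono V P⇒Q)
  ... | no  _  | no  _ = count-mono V P⇒Q

  count-< : ∀ {P Q : ℕ → Set} V {x} → (∀ {y} → P y → Q y) → x ∈ V → Q x → ¬ P x → count P V < count Q V
  count-< {P} {Q} (y ∷ V) P⇒Q (here refl) qx ¬px with em {P y} | em {Q y}
  ... | yes px | _     = ⊥-elim (¬px px)
  ... | no  _  | yes _ = s≤s (count-mono V P⇒Q)
  ... | no  _  | no ¬q = ⊥-elim (¬q qx)
  count-< {P} {Q} (y ∷ V) P⇒Q (there x∈V) qx ¬px with em {P y} | em {Q y}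
  ... | yes _  | yes _ = s≤s (count-< V P⇒Q x∈V qx ¬px)
  ... | yes py | no ¬q = ⊥-elim (¬q (P⇒Q py))
  ... | no  _  | yes _ = m≤n⇒m≤1+n (count-< V P⇒Q x∈V qx ¬px)
  ... | no  _  | no  _ = count-< V P⇒Q x∈V qx ¬px

  -- Robinson's algorithm; the unifier γ only serves to rule out clashes and failed occurs checks,
  -- and termination is by the number of variables (counted inside V), then by size.
  module _ (γ : Subst) (V : List ℕ) where

    #vars : List Equation → ℕ
    #vars E = count (λ x → OccE x E) V

    VarsIn : List Equation → Set
    VarsIn E = ∀ {x} → OccE x E → x ∈ V

    MGU : List Equation → Set
    MGU E = ∃ (MostGeneral (Unifier E))

    mutual
      unify : ∀ n s E → #vars E ≤ n → sizeE E ≤ s → VarsIn E → Unifier E γ → MGU E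
      unify n s       []                        _  _  _  _ = var , [] , λ τ _ → τ , λ _ → refl
      unify n zero    ((var _ , _) ∷ _)         _  () _  _
      unify n zero    ((fn _ _ , _) ∷ _)        _  () _  _
      unify n (suc s) ((var x , var y) ∷ E)     #≤ ≤s ⊆V u with x ≟ y
      ... | yes refl = Product.map₂ (MostGeneral-resp (refl ∷_) All.tail)
                         (unify n s E (≤-trans (count-mono V there) #≤) (≤-pred (m≤n⇒m≤1+n (≤-pred ≤s))) (⊆V ∘ there) (All.tail u))
      ... | no  x≢y  = eliminate n x (var y) E x≢y #≤ ⊆V u
      unify n (suc s) ((var x , fn g us) ∷ E)   #≤ _  ⊆V u =
        eliminate n x (fn g us) E (λ o → occurs-check γ us o (All.head u)) #≤ ⊆V u
      unify n (suc s) ((fn f ts , var y) ∷ E)   #≤ _  ⊆V u =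
        Product.map₂ (MostGeneral-resp Unifier-swap Unifier-swap)
          (eliminate n y (fn f ts) E (λ o → occurs-check γ ts o (sym (All.head u)))
            (≤-trans (count-mono V OccE-swap) #≤) (⊆V ∘ OccE-swap) (Unifier-swap u))
      unify n (suc s) ((fn f ts , fn g us) ∷ E) #≤ ≤s ⊆V (eq ∷ u) with fn-symbol-injective eq
      ... | refl = Product.map₂ MostGeneral-decompose
                     (unify n s (zipE ts us ++ E) (≤-trans (count-mono V OccE-decompose) #≤)
                       (≤-pred (≤-trans (sizeE-decompose {ts = ts} {us} {E}) ≤s)) (⊆V ∘ OccE-decompose)
                       (All.++⁺ (Unifier-zipE⁺ ts us (fn-injective eq)) u))

      eliminate : ∀ n x t E → ¬ OccT x t → #vars ((var x , t) ∷ E) ≤ n → VarsIn ((var x , t) ∷ E) →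
                  Unifier ((var x , t) ∷ E) γ → MGU ((var x , t) ∷ E)
      eliminate n x t E x∉t #≤ ⊆V u = go n (<-≤-trans fewer-vars #≤)
        where
        E′ : List Equation
        E′ = substE (x ↦ t) E
        fewer-vars : #vars E′ < #vars ((var x , t) ∷ E)
        fewer-vars = count-< V (proj₁ ∘ OccE-↦ x∉t) (⊆V (here (inj₁ refl))) (here (inj₁ refl))
                       (λ o → proj₂ (OccE-↦ x∉t o) refl)
        go : ∀ n → #vars E′ < n → MGU ((var x , t) ∷ E)
        go (suc n) #< with unify n (sizeE E′) E′ (≤-pred #<) ≤-refl (⊆V ∘ proj₁ ∘ OccE-↦ x∉t) (Unifier-↦ x∉t u)
        ... | σ , mg = (x ↦ t) ⨾ σ , MostGeneral-↦ x∉t mg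

  data SameHead : Literal → Literal → Set where
    pos : ∀ {p} (ts us : Vec Term (pArity p)) → SameHead (pos (atom p ts)) (pos (atom p us))
    neg : ∀ {p} (ts us : Vec Term (pArity p)) → SameHead (neg (atom p ts)) (neg (atom p us))

  sameHead : ∀ σ K M → substL σ K ≡ substL σ M → SameHead K M
  sameHead σ (pos (atom p ts)) (pos (atom q us)) eq with cong (Atom.pr ∘ atomOf) eq
  ... | refl = pos ts us
  sameHead σ (neg (atom p ts)) (neg (atom q us)) eq with cong (Atom.pr ∘ atomOf) eq
  ... | refl = neg ts us

  argEqs : ∀ {K M} → SameHead K M → List Equation
  argEqs (pos ts us) = zipE ts us
  argEqs (neg ts us) = zipE ts us

  argEqs⁺ : ∀ {σ K M} (h : SameHead K M) → substL σ K ≡ substL σ M → Unifier (argEqs h) σ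
  argEqs⁺ (pos ts us) eq = Unifier-zipE⁺ ts us (args-injective eq)
    where args-injective : ∀ {p} {xs ys : Vec Term (pArity p)} → pos (atom p xs) ≡ pos (atom p ys) → xs ≡ ys
          args-injective refl = refl
  argEqs⁺ (neg ts us) eq = Unifier-zipE⁺ ts us (args-injective eq)
    where args-injective : ∀ {p} {xs ys : Vec Term (pArity p)} → neg (atom p xs) ≡ neg (atom p ys) → xs ≡ ys
          args-injective refl = refl

  argEqs⁻ : ∀ {σ K M} (h : SameHead K M) → Unifier (argEqs h) σ → substL σ K ≡ substL σ M
  argEqs⁻ (pos ts us) u = cong (pos ∘ atom _) (Unifier-zipE⁻ ts us u)
  argEqs⁻ (neg ts us) u = cong (neg ∘ atom _) (Unifier-zipE⁻ ts us u)

  headEqs : ∀ {K Ms} → All (SameHead K) Ms → List Equation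
  headEqs []       = []
  headEqs (h ∷ hs) = argEqs h ++ headEqs hs

  module _ {σ : Subst} {K : Literal} where

    headEqs⁺ : ∀ {Ms} (hs : All (SameHead K) Ms) → All (λ M → substL σ K ≡ substL σ M) Ms → Unifier (headEqs hs) σ
    headEqs⁺ []       []       = []
    headEqs⁺ (h ∷ hs) (e ∷ es) = All.++⁺ (argEqs⁺ h e) (headEqs⁺ hs es)

    headEqs⁻ : ∀ {Ms} (hs : All (SameHead K) Ms) → Unifier (headEqs hs) σ → All (λ M → substL σ K ≡ substL σ M) Ms
    headEqs⁻ []       []       = []
    headEqs⁻ (h ∷ hs) u with All.++⁻ (argEqs h) u
    ... | args , rest = argEqs⁻ h args ∷ headEqs⁻ hs rest

    Unifies⇒equalToHead : ∀ {Ms} → Unifies σ (K ∷ Ms) → All (λ M → substL σ K ≡ substL σ M) Ms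
    Unifies⇒equalToHead u = All.tabulate λ M∈Ms → u (here refl) (there M∈Ms)

    equalToHead⇒Unifies : ∀ {Ms} → All (λ M → substL σ K ≡ substL σ M) Ms → Unifies σ (K ∷ Ms)
    equalToHead⇒Unifies es K₁∈ K₂∈ = trans (sym (toHead K₁∈)) (toHead K₂∈)
      where
      toHead : ∀ {M} → M ∈ K ∷ _ → substL σ K ≡ substL σ M
      toHead (here refl) = refl
      toHead (there M∈) = All.lookup es M∈

  mgu : ∀ γ Ls → Unifies γ Ls → ∃ λ σ → IsMGU σ Ls
  mgu γ []       _ = var , (λ ()) , λ τ _ → τ , λ _ → refl
  mgu γ (K ∷ Ms) u = σ , MostGeneral-resp (equalToHead⇒Unifies ∘ headEqs⁻ hs) (headEqs⁺ hs ∘ Unifies⇒equalToHead) mg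
    where
    hs : All (SameHead K) Ms
    hs = All.map (sameHead γ K _) (Unifies⇒equalToHead u)
    E : List Equation
    E = headEqs hs
    solved : MGU γ (varsE E) E
    solved = unify γ (varsE E) _ _ E ≤-refl ≤-refl (OccE⇒∈varsE E) (headEqs⁺ hs (Unifies⇒equalToHead u))
    σ = proj₁ solved
    mg = proj₂ solved

-- Terms over the finite symbol list fs, with var 0 as the only variable, are enumerable;
-- trim maps every term onto them by collapsing variables and foreign symbols to var 0.
module Trimming (em : ExcludedMiddle 0ℓ) (Sig : Signature) (fs : List (Signature.Fun Sig)) where
  open Signature Sig
  open FOL Sig
  open Syntax Sig

  mutual
    trim : Term → Term
    trim (var x)   = var 0
    trim (fn f ts) with em {f ∈ fs}
    ... | yes _ = fn f (trims ts)
    ... | no  _ = var 0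

    trims : ∀ {n} → Vec Term n → Vec Term n
    trims []       = []
    trims (t ∷ ts) = trim t ∷ trims ts

  trims-map : ∀ {n} (ts : Vec Term n) → trims ts ≡ Vec.map trim ts
  trims-map []       = refl
  trims-map (t ∷ ts) = cong (trim t ∷_) (trims-map ts)

  mutual
    trim-substT : ∀ β t → symsT t ⊆ fs → trim (substT β t) ≡ substT (trim ∘ β) t
    trim-substT β (var x)   _     = refl
    trim-substT β (fn f ts) t⊆fs with em {f ∈ fs}
    ... | yes _    = cong (fn f) (trims-substTs β ts (t⊆fs ∘ there))
    ... | no  f∉fs = ⊥-elim (f∉fs (t⊆fs (here refl)))

    trims-substTs : ∀ {n} β (ts : Vec Term n) → symsTs ts ⊆ fs → trims (substTs β ts) ≡ substTs (trim ∘ β) ts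
    trims-substTs β []       _      = refl
    trims-substTs β (t ∷ ts) ts⊆fs =
      cong₂ _∷_ (trim-substT β t (ts⊆fs ∘ ∈-++⁺ˡ)) (trims-substTs β ts (ts⊆fs ∘ ∈-++⁺ʳ (symsT t)))

  mutual
    trim-idem : ∀ t → trim (trim t) ≡ trim t
    trim-idem (var x)   = refl
    trim-idem (fn f ts) with em {f ∈ fs}
    ... | no  _    = refl
    ... | yes f∈fs with em {f ∈ fs}
    ...   | yes _    = cong (fn f) (trims-idem ts)
    ...   | no  f∉fs = ⊥-elim (f∉fs f∈fs)

    trims-idem : ∀ {n} (ts : Vec Term n) → trims (trims ts) ≡ trims ts
    trims-idem []       = refl
    trims-idem (t ∷ ts) = cong₂ _∷_ (trim-idem t) (trims-idem ts)

  trimL : Literal → Literal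
  trimL (pos (atom p ts)) = pos (atom p (trims ts))
  trimL (neg (atom p ts)) = neg (atom p (trims ts))

  trimL-substL : ∀ β K → symsL K ⊆ fs → trimL (substL β K) ≡ substL (trim ∘ β) K
  trimL-substL β (pos (atom p ts)) K⊆fs = cong (pos ∘ atom p) (trims-substTs β ts K⊆fs)
  trimL-substL β (neg (atom p ts)) K⊆fs = cong (neg ∘ atom p) (trims-substTs β ts K⊆fs)

  trimL-substL-cong : ∀ {μ ν} K → symsL K ⊆ fs → (∀ x → OccL x K → trim (μ x) ≡ trim (ν x)) →
                      trimL (substL μ K) ≡ trimL (substL ν K)
  trimL-substL-cong {μ} {ν} K K⊆fs eq = begin
    trimL (substL μ K)     ≡⟨ trimL-substL μ K K⊆fs ⟩
    substL (trim ∘ μ) K    ≡⟨ substL-cong K eq ⟩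
    substL (trim ∘ ν) K    ≡⟨ trimL-substL ν K K⊆fs ⟨
    trimL (substL ν K)     ∎
    where open ≡-Reasoning

  vectors : List Term → (k : ℕ) → List (Vec Term k)
  vectors l zero    = [] ∷ []
  vectors l (suc k) = concatMap (λ t → map (t ∷_) (vectors l k)) l

  ∈-vectors⁺ : ∀ {l k} {v : Vec Term k} → VAll.All (_∈ l) v → v ∈ vectors l k
  ∈-vectors⁺ VAll.[]            = here refl
  ∈-vectors⁺ {l} (t∈l VAll.∷ ts) = ∈-concatMap⁺ _ (lose t∈l (∈-map⁺ _ (∈-vectors⁺ ts)))

  ∈-vectors⁻ : ∀ {l k} {v : Vec Term k} → v ∈ vectors l k → VAll.All (_∈ l) v
  ∈-vectors⁻ {k = zero}  {[]}    _ = VAll.[]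
  ∈-vectors⁻ {l} {suc k} {t ∷ v} v∈ with find (∈-concatMap⁻ _ {xs = l} v∈)
  ... | u , u∈l , ∈map with ∈-map⁻ _ ∈map
  ...   | w , w∈ , refl = u∈l VAll.∷ ∈-vectors⁻ w∈

  terms : ℕ → List Term
  terms zero    = var 0 ∷ []
  terms (suc n) = var 0 ∷ concatMap (λ f → map (fn f) (vectors (terms n) (fArity f))) fs

  terms-suc : ∀ n {t} → t ∈ terms n → t ∈ terms (suc n)
  terms-suc zero    (here refl) = here refl
  terms-suc (suc n) (here refl) = here refl
  terms-suc (suc n) (there t∈) with find (∈-concatMap⁻ _ {xs = fs} t∈)
  ... | f , f∈fs , ∈map with ∈-map⁻ (fn f) ∈map
  ...   | v , v∈ , refl =
    there (∈-concatMap⁺ _ (lose f∈fs (∈-map⁺ (fn f) (∈-vectors⁺ (VAll.map (terms-suc n) (∈-vectors⁻ v∈))))))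

  terms-mono : ∀ {n k t} → n ≤ k → t ∈ terms n → t ∈ terms k
  terms-mono = ascending-mono (λ n t → t ∈ terms n) (terms-suc _)

  All-terms-mono : ∀ {n k m} {v : Vec Term m} → n ≤ k → VAll.All (_∈ terms n) v → VAll.All (_∈ terms k) v
  All-terms-mono n≤k = VAll.map (terms-mono n≤k)

  mutual
    trim-enumerated : ∀ t → ∃ λ n → trim t ∈ terms n
    trim-enumerated (var x) = 0 , here refl
    trim-enumerated (fn f ts) with em {f ∈ fs}
    ... | no  _    = 0 , here refl
    ... | yes f∈fs with trims-enumerated ts
    ...   | n , ts∈ = suc n , there (∈-concatMap⁺ _ (lose f∈fs (∈-map⁺ (fn f) (∈-vectors⁺ ts∈))))

    trims-enumerated : ∀ {k} (ts : Vec Term k) → ∃ λ n → VAll.All (_∈ terms n) (trims ts)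
    trims-enumerated []       = 0 , VAll.[]
    trims-enumerated (t ∷ ts) with trim-enumerated t | trims-enumerated ts
    ... | m , t∈ | n , ts∈ = m + n , terms-mono (m≤m+n m n) t∈ VAll.∷ All-terms-mono (m≤n+m n m) ts∈

  instantiate : (vs : List ℕ) → Vec Term (length vs) → Subst
  instantiate []       []       y = var 0
  instantiate (x ∷ vs) (t ∷ ts) y with y ≟ x
  ... | yes _ = t
  ... | no  _ = instantiate vs ts y

  instantiate-agrees : ∀ (g : Subst) vs {y} → y ∈ vs → instantiate vs (Vec.map g (Vec.fromList vs)) y ≡ g y
  instantiate-agrees g (x ∷ vs) {y} y∈ with y ≟ x | y∈
  ... | yes refl | _          = refl
  ... | no  y≢x  | here y≡x   = ⊥-elim (y≢x y≡x)
  ... | no  _    | there y∈vs = instantiate-agrees g vs y∈vs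

  instances : List ℕ → ℕ → List Subst
  instances vs n = map (instantiate vs) (vectors (terms n) (length vs))

  trimmed-instance-enumerated : ∀ vs β → ∃ λ N → ∀ {k} → N ≤ k →
    instantiate vs (Vec.map (trim ∘ β) (Vec.fromList vs)) ∈ instances vs k
  trimmed-instance-enumerated vs β with trims-enumerated (Vec.map β (Vec.fromList vs))
  ... | N , ts∈ = N , λ N≤k → ∈-map⁺ (instantiate vs) (∈-vectors⁺ (All-terms-mono N≤k (subst (VAll.All _) trims≡ ts∈)))
    where
    trims≡ : trims (Vec.map β (Vec.fromList vs)) ≡ Vec.map (trim ∘ β) (Vec.fromList vs)
    trims≡ = trans (trims-map _) (sym (Vec.map-∘ trim β _))

module BlockedClauses (em : ExcludedMiddle 0ℓ) (Sig : Signature) where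
  open Signature Sig
  open FOL Sig
  open Syntax Sig
  open Unification em Sig using (mgu; equalToHead⇒Unifies)

  dne : {P : Set} → ¬ ¬ P → P
  dne = em⇒dne em

  module Extension (F : Formula) (C : Clause)
           (disjoint : ∀ D → (F ∖[ C ]) D → VarDisjoint C D)
           (L : Literal) (L∈C : L ∈ C)
           (blocked : ∀ D R → (F ∖[ C ]) D → Resolvent L C D R → Valid R)
           (I : Structure) (I⊨F∖C : ∀ D → (F ∖[ C ]) D → Satisfies I D) where

    relevant : List Fun
    relevant = symsC C ++ symsF F

    open Trimming em Sig relevant

    Relevant : Literal → Set
    Relevant K = symsL K ⊆ relevant

    C-relevant : ∀ {K} → K ∈ C → Relevant K
    C-relevant K∈C f∈ = ∈-++⁺ˡ (∈-concatMap⁺ symsL (lose K∈C f∈))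

    F-relevant : ∀ {D K} → D ∈ F → K ∈ D → Relevant K
    F-relevant D∈F K∈D f∈ = ∈-++⁺ʳ (symsC C) (∈-concatMap⁺ symsC (lose D∈F (∈-concatMap⁺ symsL (lose K∈D f∈))))

    open Structure I using (predI) renaming (elem to default)

    TrueInI : Atom → Set
    TrueInI (atom p ts) = predI p (evalTs I (λ _ → default) ts)

    AtomSet : Set₁
    AtomSet = Atom → Set

    _⊆ₐ_ : AtomSet → AtomSet → Set
    X ⊆ₐ Y = ∀ {b} → X b → Y b

    AtomHolds : AtomSet → Atom → Set
    AtomHolds X a = (X a × Positive L) ⊎ (¬ X a × TrueInI a)

    GroundHolds : AtomSet → Literal → Set
    GroundHolds X (pos a) = AtomHolds X a
    GroundHolds X (neg a) = ¬ AtomHolds X a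

    Holds : AtomSet → Subst → Literal → Set
    Holds X β K = GroundHolds X (trimL (substL β K))

    atomAt : Subst → Literal → Atom
    atomAt β K = atomOf (trimL (substL β K))

    Model : AtomSet → Set
    Model X = ∀ D → (F ∖[ C ]) D → ∀ β → Any (Holds X β) D

    termModel : AtomSet → Structure
    termModel X = record { Dom = Term ; elem = var 0 ; funI = fn ; predI = λ p ts → AtomHolds X (atom p (trims ts)) }

    mutual
      evalT-termModel : ∀ X β t → evalT (termModel X) β t ≡ substT β t
      evalT-termModel X β (var x)   = refl
      evalT-termModel X β (fn f ts) = cong (fn f) (evalTs-termModel X β ts)

      evalTs-termModel : ∀ X {n} β (ts : Vec Term n) → evalTs (termModel X) β ts ≡ substTs β ts
      evalTs-termModel X β []       = refl
      evalTs-termModel X β (t ∷ ts) = cong₂ _∷_ (evalT-termModel X β t) (evalTs-termModel X β ts)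

    LitTrue-termModel : ∀ X β K → Holds X β K → LitTrue (termModel X) β K
    LitTrue-termModel X β (pos (atom p ts)) = subst (λ us → AtomHolds X (atom p (trims us))) (sym (evalTs-termModel X β ts))
    LitTrue-termModel X β (neg (atom p ts)) = subst (λ us → ¬ AtomHolds X (atom p (trims us))) (sym (evalTs-termModel X β ts))

    termModel-LitTrue : ∀ X β K → LitTrue (termModel X) β K → Holds X β K
    termModel-LitTrue X β (pos (atom p ts)) = subst (λ us → AtomHolds X (atom p (trims us))) (evalTs-termModel X β ts)
    termModel-LitTrue X β (neg (atom p ts)) = subst (λ us → ¬ AtomHolds X (atom p (trims us))) (evalTs-termModel X β ts)

    Holds-cong : ∀ X {μ ν} K → Relevant K → (∀ x → OccL x K → trim (μ x) ≡ trim (ν x)) → Holds X μ K → Holds X ν K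
    Holds-cong X K rel eq = subst (GroundHolds X) (trimL-substL-cong K rel eq)

    Holds-ext : ∀ X {μ ν} K → (∀ x → μ x ≡ ν x) → Holds X μ K → Holds X ν K
    Holds-ext X K μ≗ν = subst (GroundHolds X ∘ trimL) (substL-cong K (λ x _ → μ≗ν x))

    Holds-⨾ : ∀ X σ ρ K → Holds X ρ (substL σ K) → Holds X (σ ⨾ ρ) K
    Holds-⨾ X σ ρ K = subst (GroundHolds X ∘ trimL) (substL-⨾ σ ρ K)

    Holds-agree : ∀ {X Y} β K → X (atomAt β K) ⇔ Y (atomAt β K) → Holds X β K → Holds Y β K
    Holds-agree β K = GroundHolds-agree (trimL (substL β K))
      where
      AtomHolds-agree : ∀ {X Y} a → X a ⇔ Y a → AtomHolds X a → AtomHolds Y a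
      AtomHolds-agree a X⇔Y = Sum.map (Product.map₁ (Equivalence.to X⇔Y)) (Product.map₁ (_∘ Equivalence.from X⇔Y))
      GroundHolds-agree : ∀ {X Y} K → X (atomOf K) ⇔ Y (atomOf K) → GroundHolds X K → GroundHolds Y K
      GroundHolds-agree {X} {Y} (pos a) X⇔Y = AtomHolds-agree {X} {Y} a X⇔Y
      GroundHolds-agree {X} {Y} (neg a) X⇔Y = _∘ AtomHolds-agree {Y} {X} a (⇔.sym X⇔Y)

    Holds-flipped : ∀ {X} β K → X (atomAt β K) → Holds X β K ⇔ SameSign L K
    Holds-flipped β (pos (atom p ts)) x∈X = mk⇔ [ proj₂ , (λ (x∉X , _) → ⊥-elim (x∉X x∈X)) ] (λ pol → inj₁ (x∈X , pol))
    Holds-flipped β (neg (atom p ts)) x∈X = mk⇔ (λ ¬holds pol → ¬holds (inj₁ (x∈X , pol)))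
                                               (λ ¬pol → [ ¬pol ∘ proj₂ , (λ (x∉X , _) → x∉X x∈X) ])

    SameSign-trimL-substL : ∀ β K → SameSign L (trimL (substL β K)) ≡ SameSign L K
    SameSign-trimL-substL β (pos (atom p ts)) = refl
    SameSign-trimL-substL β (neg (atom p ts)) = refl

    compl-of-opposite : ∀ K M → atomOf K ≡ atomOf M → SameSign L K → ¬ SameSign L M → compl M ≡ K
    compl-of-opposite (pos a) (pos b) _    pol ¬pol = ⊥-elim (¬pol pol)
    compl-of-opposite (pos a) (neg b) refl _   _    = refl
    compl-of-opposite (neg a) (pos b) refl _   _    = refl
    compl-of-opposite (neg a) (neg b) _    pol ¬pol = ⊥-elim (¬pol pol)

    Model-∅ : Model (λ _ → ⊥)
    Model-∅ D D∈F∖C β =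
      let K , K∈D , true = find (I⊨F∖C D D∈F∖C (evalT I (λ _ → default) ∘ trim ∘ β))
      in lose K∈D (Holds-∅ K (F-relevant (proj₁ D∈F∖C) K∈D) true)
      where
      TrueInI-trim : ∀ p (ts : Vec Term (pArity p)) → symsTs ts ⊆ relevant →
                     TrueInI (atom p (trims (substTs β ts))) ≡ predI p (evalTs I (evalT I (λ _ → default) ∘ trim ∘ β) ts)
      TrueInI-trim p ts rel = cong (predI p) (trans (cong (evalTs I _) (trims-substTs β ts rel)) (evalTs-substTs I _ (trim ∘ β) ts))
      Holds-∅ : ∀ K → Relevant K → LitTrue I (evalT I (λ _ → default) ∘ trim ∘ β) K → Holds (λ _ → ⊥) β K
      Holds-∅ (pos (atom p ts)) rel true = inj₂ ((λ ()) , subst id (sym (TrueInI-trim p ts rel)) true)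
      Holds-∅ (neg (atom p ts)) rel false = [ proj₁ , (λ (_ , true) → false (subst id (TrueInI-trim p ts rel) true)) ]

    merge : Subst → Subst → Subst
    merge λ₀ β x with em {OccC x C}
    ... | yes _ = λ₀ x
    ... | no  _ = β x

    merge-on-C : ∀ λ₀ β {x} → OccC x C → merge λ₀ β x ≡ λ₀ x
    merge-on-C λ₀ β {x} o with em {OccC x C}
    ... | yes _ = refl
    ... | no ¬o = ⊥-elim (¬o o)

    merge-on-D : ∀ λ₀ β {x D} → (OccC x C → OccC x D → ⊥) → OccC x D → merge λ₀ β x ≡ β x
    merge-on-D λ₀ β {x} disj o with em {OccC x C}
    ... | yes oC = ⊥-elim (disj oC o)
    ... | no  _  = refl

    insert : AtomSet → Atom → AtomSet
    insert X a b = X b ⊎ b ≡ a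

    module _ {X : AtomSet} (X⊨ : Model X) {λ₀ : Subst} (C-false : ¬ Any (Holds X λ₀) C) where
      private
        a : Atom
        a = atomAt λ₀ L

      Holds-insert : ∀ {β} K → atomAt β K ≢ a → Holds X β K → Holds (insert X a) β K
      Holds-insert K K≢a = Holds-agree _ K (mk⇔ inj₁ [ id , ⊥-elim ∘ K≢a ])

      -- A clause D of F ∖ {C} falsified by the insertion yields an L-resolvent of C and D that is
      -- false at the combined instance γ, although blocking makes it valid.
      module Resolution (D : Clause) (D∈ : (F ∖[ C ]) D) (β : Subst)
                        (D-false : ¬ Any (Holds (insert X a) β) D) where

        at-a? : Decidable (λ K → atomAt β K ≡ a)
        at-a? K = em

        Ns D′ : List Literal
        Ns = filter at-a? D
        D′ = filter (∁? at-a?) D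

        mentioning-literal : ∃ λ K → K ∈ D × atomAt β K ≡ a
        mentioning-literal =
          let K , K∈D , holds = find (X⊨ D D∈ β)
          in K , K∈D , dne (λ K≢a → D-false (lose K∈D (Holds-insert K K≢a holds)))

        Ns-nonempty : Ns ≢ []
        Ns-nonempty = let K , K∈D , K≡a = mentioning-literal in ∈⇒≢[] (∈-filter⁺ at-a? K∈D K≡a)

        Ns-opposite : ∀ {N} → N ∈ Ns → ¬ SameSign L N
        Ns-opposite N∈Ns sign =
          let N∈D , N≡a = ∈-filter⁻ at-a? N∈Ns
          in D-false (lose N∈D (Equivalence.from (Holds-flipped β _ (inj₂ N≡a)) sign))

        γ : Subst
        γ = trim ∘ merge λ₀ β

        γ-on-C : ∀ {x} → OccC x C → γ x ≡ trim (λ₀ x)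
        γ-on-C = cong trim ∘ merge-on-C λ₀ β

        γ-on-D : ∀ {x} → OccC x D → γ x ≡ trim (β x)
        γ-on-D = cong trim ∘ merge-on-D λ₀ β (disjoint D D∈ _)

        substL-γ-C : ∀ {K} → K ∈ C → substL γ K ≡ trimL (substL λ₀ K)
        substL-γ-C {K} K∈C = trans (substL-cong K (λ x o → γ-on-C (lose K∈C o))) (sym (trimL-substL λ₀ K (C-relevant K∈C)))

        substL-γ-D : ∀ {K} → K ∈ D → substL γ K ≡ trimL (substL β K)
        substL-γ-D {K} K∈D = trans (substL-cong K (λ x o → γ-on-D (lose K∈D o))) (sym (trimL-substL β K (F-relevant (proj₁ D∈) K∈D)))

        γ-unifies : Unifies γ (L ∷ map compl Ns)
        γ-unifies = equalToHead⇒Unifies (All.map⁺ (All.tabulate L≡compl))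
          where
          open ≡-Reasoning
          L≡compl : ∀ {N} → N ∈ Ns → substL γ L ≡ substL γ (compl N)
          L≡compl {N} N∈Ns = let N∈D , N≡a = ∈-filter⁻ at-a? N∈Ns in begin
            substL γ L                       ≡⟨ substL-γ-C L∈C ⟩
            trimL (substL λ₀ L)              ≡⟨ compl-of-opposite _ _ (sym N≡a)
                                                  (subst id (sym (SameSign-trimL-substL λ₀ L)) (SameSign-refl L))
                                                  (Ns-opposite N∈Ns ∘ subst id (SameSign-trimL-substL β N)) ⟨
            compl (trimL (substL β N))       ≡⟨ cong compl (substL-γ-D N∈D) ⟨
            compl (substL γ N)               ≡⟨ substL-compl γ N ⟨
            substL γ (compl N)               ∎

        σ : Subst
        σ = proj₁ (mgu γ (L ∷ map compl Ns) γ-unifies)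

        σ-mgu : IsMGU σ (L ∷ map compl Ns)
        σ-mgu = proj₂ (mgu γ (L ∷ map compl Ns) γ-unifies)

        C′ : Clause
        C′ = proj₁ (∈⇒↭∷ L∈C)

        resolvent : Resolvent L C D (substC σ (C′ ++ D′))
        resolvent = C′ , Ns , D′ , σ , proj₂ (∈⇒↭∷ L∈C) , ↭-filter++filter-∁ at-a? D , Ns-nonempty , σ-mgu , refl

        resolvent-holds-at-γ : Any (Holds X γ) (C′ ++ D′)
        resolvent-holds-at-γ =
          let ρ , γ≗σ⨾ρ = proj₂ σ-mgu γ γ-unifies
          in Any.map (λ {K} → Holds-ext X K (sym ∘ γ≗σ⨾ρ) ∘ Holds-⨾ X σ ρ K ∘ termModel-LitTrue X ρ (substL σ K))
                     (Any.map⁻ (blocked D _ D∈ resolvent (termModel X) ρ))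

        contradiction : ⊥
        contradiction =
          let K , K∈ , holds = find resolvent-holds-at-γ
          in [ from-C′ K holds , from-D′ K holds ] (Any.++⁻ C′ K∈)
          where
          from-C′ : ∀ K → Holds X γ K → K ∈ C′ → ⊥
          from-C′ K holds K∈C′ = C-false (lose K∈C (Holds-cong X K (C-relevant K∈C) agree holds))
            where
            K∈C : K ∈ C
            K∈C = ∈-resp-↭ (↭-sym (proj₂ (∈⇒↭∷ L∈C))) (there K∈C′)
            agree : ∀ x → OccL x K → trim (γ x) ≡ trim (λ₀ x)
            agree x o = trans (cong trim (γ-on-C (lose K∈C o))) (trim-idem (λ₀ x))

          from-D′ : ∀ K → Holds X γ K → K ∈ D′ → ⊥
          from-D′ K holds K∈D′ =
            D-false (lose K∈D (Holds-insert K K≢a (Holds-cong X K (F-relevant (proj₁ D∈) K∈D) agree holds)))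
            where
            K∈D : K ∈ D
            K∈D = proj₁ (∈-filter⁻ (∁? at-a?) {xs = D} K∈D′)
            K≢a : atomAt β K ≢ a
            K≢a = proj₂ (∈-filter⁻ (∁? at-a?) {xs = D} K∈D′)
            agree : ∀ x → OccL x K → trim (γ x) ≡ trim (β x)
            agree x o = trans (cong trim (γ-on-D (lose K∈D o))) (trim-idem (β x))

      Model-insert : Model (insert X a)
      Model-insert D D∈ β = dne (Resolution.contradiction D D∈ β)

    Model-resp : ∀ {X Y} → (∀ {b} → X b ⇔ Y b) → Model X → Model Y
    Model-resp X⇔Y X⊨ D D∈ β = Any.map (Holds-agree β _ X⇔Y) (X⊨ D D∈ β)

    flip : AtomSet → Subst → AtomSet
    flip X λ₀ b = X b ⊎ (¬ Any (Holds X λ₀) C × b ≡ atomAt λ₀ L)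

    Model-flip : ∀ {X} λ₀ → Model X → Model (flip X λ₀)
    Model-flip {X} λ₀ X⊨ = by-cases em
      where
      by-cases : Dec (¬ Any (Holds X λ₀) C) → Model (flip X λ₀)
      by-cases (yes C-false) = Model-resp (mk⇔ (Sum.map₂ (C-false ,_)) (Sum.map₂ proj₂)) (Model-insert X⊨ C-false)
      by-cases (no C-true)   = Model-resp (mk⇔ inj₁ [ id , ⊥-elim ∘ C-true ∘ proj₁ ]) X⊨

    flipAll : AtomSet → List Subst → AtomSet
    flipAll = foldl flip

    flipAll-⊇ : ∀ {X} ls → X ⊆ₐ flipAll X ls
    flipAll-⊇ []        = id
    flipAll-⊇ (λ₀ ∷ ls) = flipAll-⊇ ls ∘ inj₁

    Model-flipAll : ∀ {X} ls → Model X → Model (flipAll X ls)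
    Model-flipAll []        = id
    Model-flipAll (λ₀ ∷ ls) = Model-flipAll ls ∘ Model-flip λ₀

    flipAll-visits : ∀ {X μ ls} → μ ∈ ls → ∃ λ Y → X ⊆ₐ Y × flip Y μ ⊆ₐ flipAll X ls
    flipAll-visits {X} {ls = μ ∷ ls} (here refl) = X , id , flipAll-⊇ ls
    flipAll-visits {X} {ls = λ₀ ∷ ls} (there μ∈) =
      let Y , X⊆Y , flip⊆ = flipAll-visits μ∈ in Y , X⊆Y ∘ inj₁ , flip⊆

    stage : ℕ → AtomSet
    stage zero    = λ _ → ⊥
    stage (suc n) = flipAll (stage n) (instances (varsC C) n)

    stage-mono : ∀ {m n} → m ≤ n → stage m ⊆ₐ stage n
    stage-mono m≤n = ascending-mono stage (λ {n} → flipAll-⊇ (instances (varsC C) n)) m≤n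

    Model-stage : ∀ n → Model (stage n)
    Model-stage zero    = Model-∅
    Model-stage (suc n) = Model-flipAll (instances (varsC C) n) (Model-stage n)

    limit : AtomSet
    limit b = ∃ λ n → stage n b

    stabilises : ∀ β D → ∃ λ n → ∀ {K} → K ∈ D → limit (atomAt β K) → stage n (atomAt β K)
    stabilises β []      = 0 , λ ()
    stabilises β (K ∷ D) =
      let m , K-stable = stabilises-at (em {limit (atomAt β K)})
          n , D-stable = stabilises β D
      in m + n , λ { (here refl) → stage-mono (m≤m+n m n) ∘ K-stable
                   ; (there K∈D) → stage-mono (m≤n+m n m) ∘ D-stable K∈D }
      where
      stabilises-at : ∀ {b} → Dec (limit b) → ∃ λ n → limit b → stage n b
      stabilises-at (yes (n , b∈)) = n , λ _ → b∈
      stabilises-at (no  b∉)       = 0 , ⊥-elim ∘ b∉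

    Holds-limit : ∀ β D → ∃ λ n → ∀ {Y} → stage n ⊆ₐ Y → Y ⊆ₐ limit → ∀ {K} → K ∈ D → Holds Y β K → Holds limit β K
    Holds-limit β D = let n , stable = stabilises β D in n , λ low high K∈D → Holds-agree β _ (mk⇔ high (low ∘ stable K∈D))

    Model-limit : Model limit
    Model-limit D D∈ β =
      let n , agree = Holds-limit β D
          K , K∈D , holds = find (Model-stage n D D∈ β)
      in lose K∈D (agree id (n ,_) K∈D holds)

    -- Cβ is decided while processing its trimmed instance μ at a stage beyond the one where Cβ stabilises.
    limit-satisfies-C : ∀ β → Any (Holds limit β) C
    limit-satisfies-C β = by-cases em
      where
      vs = varsC C
      n₀ = proj₁ (Holds-limit β C)
      N = proj₁ (trimmed-instance-enumerated vs β)
      μ = instantiate vs (Vec.map (trim ∘ β) (Vec.fromList vs))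
      visit = flipAll-visits (proj₂ (trimmed-instance-enumerated vs β) (m≤n+m N n₀))
      Y = proj₁ visit
      stage⊆Y : stage (n₀ + N) ⊆ₐ Y
      stage⊆Y = proj₁ (proj₂ visit)
      flip⊆limit : flip Y μ ⊆ₐ limit
      flip⊆limit b∈ = suc (n₀ + N) , proj₂ (proj₂ visit) b∈

      μ⇒β : ∀ {Z K} → K ∈ C → Holds Z μ K → Holds Z β K
      μ⇒β {Z} {K} K∈C = Holds-cong Z K (C-relevant K∈C) λ x o →
        trans (cong trim (instantiate-agrees (trim ∘ β) vs (OccC⇒∈varsC C (lose K∈C o)))) (trim-idem (β x))

      by-cases : Dec (¬ Any (Holds Y μ) C) → Any (Holds limit β) C
      by-cases (yes C-false) = lose L∈C (μ⇒β L∈C (Equivalence.from L-flipped (SameSign-refl L)))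
        where L-flipped = Holds-flipped μ L (flip⊆limit (inj₂ (C-false , refl)))
      by-cases (no C-true) =
        let K , K∈C , holds = find (dne C-true)
        in lose K∈C (proj₂ (Holds-limit β C) (stage⊆Y ∘ stage-mono (m≤m+n n₀ N)) (flip⊆limit ∘ inj₁) K∈C (μ⇒β K∈C holds))

    termModel-limit⊨F∪C : ∀ D → (F ∪[ C ]) D → Satisfies (termModel limit) D
    termModel-limit⊨F∪C D (inj₂ D↭C) β = Any-resp-↭ (↭-sym D↭C) (Any.map (LitTrue-termModel limit β _) (limit-satisfies-C β))
    termModel-limit⊨F∪C D (inj₁ D∈F) β = by-cases em
      where
      by-cases : Dec (D ↭ C) → Any (LitTrue (termModel limit) β) D
      by-cases (yes D↭C) = termModel-limit⊨F∪C D (inj₂ D↭C) β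
      by-cases (no  D≉C) = Any.map (LitTrue-termModel limit β _) (Model-limit D (D∈F , D≉C) β)

theorem3 : ExcludedMiddle 0ℓ → (Sig : Signature) → let open FOL Sig in
    (F : Formula) (C : Clause) →
    (∀ D → (F ∖[ C ]) D → VarDisjoint C D) →
    Blocked C F →
    SatEquivalent (F ∖[ C ]) (F ∪[ C ])
theorem3 em Sig F C disjoint (L , L∈C , blocked) = extend , restrict
  where
  open FOL Sig

  extend : Satisfiable (F ∖[ C ]) → Satisfiable (F ∪[ C ])
  extend (I , I⊨F∖C) = termModel limit , termModel-limit⊨F∪C
    where open BlockedClauses.Extension em Sig F C disjoint L L∈C blocked I I⊨F∖C

  restrict : Satisfiable (F ∪[ C ]) → Satisfiable (F ∖[ C ])
  restrict (I , I⊨F∪C) = I , λ D (D∈F , _) → I⊨F∪C D (inj₁ D∈F)
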